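{- Let $k,r\geq 1$, let $I_d\subseteq\{1,2,\dots,r\}$ be a set of $d$ colours, and let $n\geq k$. Then $$\Big|S_n^{(r)}\Big(\bigcup_{m=1}^k T_{k,r}^m(I_d)\Big)\Big|=r^{k-1}(r-d)^{n+1-k}\,n!.$$
   Context: $S_n^{(r)}$ denotes the set of coloured permutations of $\{1,\dots,n\}$ with colours $\{1,\dots,r\}$: sequences $\psi=(\alpha_1^{(v_1)},\dots,\alpha_n^{(v_n)})$ where $(\alpha_1,\dots,\alpha_n)$ is a permutation of $\{1,\dots,n\}$ and each $v_i\in\{1,\dots,r\}$ is the colour of the symbol $\alpha_i$. For $\phi=(\tau_1^{(s_1)},\dots,\tau_k^{(s_k)})\in S_k^{(r)}$, $\psi$ contains $\phi$ if there are indices $1\leq i_1<\dots<i_k\leq n$ such that $(\alpha_{i_1},\dots,\alpha_{i_k})$ is order-isomorphic to $(\tau_1,\dots,\tau_k)$ and $v_{i_j}=s_j$ for all $j$; otherwise $\psi$ avoids $\phi$. For a set $T$ of coloured patterns, $S_n^{(r)}(T)$ is the set of $\psi\in S_n^{(r)}$ avoiding every $\phi\in T$. For $I_d\subseteq\{1,\dots,r\}$ with $|I_d|=d$ and $1\le m\le k$, $T_{k,r}^m(I_d)$ is the set of all $\phi\in S_k^{(r)}$ whose first entry is the symbol $m$ with colour in $I_d$. -}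

module Defs where

open import Data.Nat using (ℕ)
open import Data.Fin using (Fin; zero; _<_)
open import Data.Fin.Subset using (Subset; _∈_)
open import Data.Vec using (Vec; lookup; _∷_)
open import Data.Product using (_×_; Σ; ∃)
open import Function.Bundles using (_⇔_)
open import Relation.Binary.PropositionalEquality using (_≡_)
open import Relation.Nullary using (¬_)

-- Symbols {1..n} are encoded as Fin n = {0..n-1}, colours {1..r} as Fin r.
record CWord (n r : ℕ) : Set where
  constructor cw
  field
    word : Vec (Fin n) n
    col  : Vec (Fin r) n
open CWord public

-- The underlying word is a permutation of the symbols (injective, hence bijective).
IsPerm : ∀ {n r} → CWord n r → Set
IsPerm {n} ψ = ∀ (i j : Fin n) → lookup (word ψ) i ≡ lookup (word ψ) j → i ≡ j

InS : ∀ {n r} → CWord n r → Set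
InS = IsPerm

Contains : ∀ {n k r} → CWord n r → CWord k r → Set
Contains {n} {k} ψ φ =
  Σ (Fin k → Fin n) λ ι →
    (∀ a b → a < b → ι a < ι b) ×
    (∀ a b → (lookup (word ψ) (ι a) < lookup (word ψ) (ι b)) ⇔ (lookup (word φ) a < lookup (word φ) b)) ×
    (∀ a → lookup (col ψ) (ι a) ≡ lookup (col φ) a)

Avoids : ∀ {n k r} → CWord n r → CWord k r → Set
Avoids ψ φ = ¬ Contains ψ φ

-- φ ∈ T_{k,r}^m(I): φ ∈ S_k^(r) (k = suc k'), whose first entry is the symbol m
-- (m ∈ {1..k} encoded as Fin k) with colour in I.
InT : ∀ {k' r} → Fin (ℕ.suc k') → Subset r → CWord (ℕ.suc k') r → Set
InT m I φ = InS φ × (lookup (word φ) zero ≡ m) × (lookup (col φ) zero ∈ I)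

-- A coloured permutation ψ avoids every pattern of length k = k' + 1 whose first entry has a colour
-- in I exactly when no position i with i + k' < n carries a colour in I. Indeed, the first entry of
-- an occurrence sits at such a position, and conversely the k consecutive entries starting at such a
-- position, standardised by their ranks, form a permutation pattern that ψ contains and whose first
-- colour is that of position i. The avoiders are therefore the pairs of a permutation (n! choices)
-- and a colouring whose first n - k' colours avoid I ((r - d)^(n - k') r^k' choices).
module Submission where

open import Defs
open import Data.Nat as ℕ using (ℕ; zero; suc; _+_; _*_; _∸_; _^_; _≤_; z≤n; s≤s; pred; _!)
open import Data.Nat.Properties
  using ( *-comm; *-assoc; *-identityˡ; *-identityʳ; +-identityʳ; +-suc; +-∸-assoc; +-monoˡ-≤; +-monoʳ-≤; +-monoʳ-<
        ; ≤-refl; ≤-reflexive; ≤-trans; ≤-<-trans; <⇒≤; n≤1+n; n∸n≡0; m∸n≤m; m∸[m∸n]≡n; pred[m∸n]≡m∸[1+n]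
        ; m+n≤o⇒m≤o∸n; m≤o∸n⇒m+n≤o; module ≤-Reasoning)
open import Data.Fin using (Fin; zero; suc; toℕ; fromℕ; fromℕ<; _<_)
open import Data.Fin.Properties
  using (_≟_; _<?_; 0≢1+n; suc-injective; <-cmp; <-irrefl; <-asym; <-trans; toℕ-fromℕ<; toℕ-injective; toℕ<n; toℕ≤pred[n])
open import Data.Fin.Subset using (Subset; ∣_∣; _⊂_; ∁; inside; outside) renaming (_∈_ to _∈ₛ_; _∉_ to _∉ₛ_)
open import Data.Fin.Subset.Properties using (p⊂q⇒∣p∣<∣q∣; ∈⊤; ∣⊤∣≡n; x∈∁p⇒x∉p; x∉p⇒x∈∁p; ∣∁p∣≡n∸∣p∣)
open import Data.Bool using (true; false)
open import Data.List using (List; []; _∷_; [_]; _++_; map; length; allFin; filter)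
open import Data.List.Properties using (length-++; length-map; length-tabulate; filter-all)
open import Data.List.Membership.Propositional using (_∈_; _∉_)
open import Data.List.Membership.Propositional.Properties
  using (∈-allFin; ∈-map⁺; ∈-map⁻; ∈-++⁺ˡ; ∈-++⁺ʳ; ∈-++⁻; ∈-filter⁺; ∈-filter⁻)
open import Data.List.Relation.Unary.Any using (here; there)
import Data.List.Relation.Unary.All as All
open import Data.List.Relation.Unary.All.Properties using (All¬⇒¬Any; ¬Any⇒All¬)
open import Data.List.Relation.Unary.Unique.Propositional using (Unique; []; _∷_)
import Data.List.Relation.Unary.Unique.Propositional.Properties as Unique
open import Data.Vec using (Vec; []; _∷_; here; there; lookup; tabulate)
open import Data.Vec.Properties using (∷-injective; lookup∘tabulate; lookup⇒[]=; []=⇒lookup)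
open import Data.Product using (_×_; _,_; ∃; ∃₂; proj₁; proj₂; swap)
open import Data.Sum using (inj₁; inj₂)
open import Data.Empty using (⊥-elim)
open import Function using (_∘_; const)
open import Function.Bundles using (_⇔_; mk⇔)
open import Relation.Binary using (tri<; tri≈; tri>)
open import Relation.Binary.PropositionalEquality hiding ([_])
open import Relation.Nullary using (¬_; does; yes; no; ¬?)
open import Relation.Nullary.Decidable using (dec-true; dec-false; decidable-stable)

module _ {A B C : Set} (g : A → B → C) where

  sigmaWith : List A → (A → List B) → List C
  sigmaWith []       f = []
  sigmaWith (a ∷ as) f = map (g a) (f a) ++ sigmaWith as f

  ∈-sigmaWith⁺ : ∀ {as f a b} → a ∈ as → b ∈ f a → g a b ∈ sigmaWith as f
  ∈-sigmaWith⁺ {a ∷ _}  {f} (here refl) b∈ = ∈-++⁺ˡ (∈-map⁺ (g a) b∈)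
  ∈-sigmaWith⁺ {a' ∷ _} {f} (there a∈)  b∈ = ∈-++⁺ʳ (map (g a') (f a')) (∈-sigmaWith⁺ a∈ b∈)

  ∈-sigmaWith⁻ : ∀ as f {c} → c ∈ sigmaWith as f → ∃₂ λ a b → a ∈ as × b ∈ f a × c ≡ g a b
  ∈-sigmaWith⁻ (a ∷ as) f c∈ with ∈-++⁻ (map (g a) (f a)) c∈
  ... | inj₁ c∈map with ∈-map⁻ (g a) c∈map
  ...   | b , b∈ , refl = a , b , here refl , b∈ , refl
  ∈-sigmaWith⁻ (a ∷ as) f c∈ | inj₂ c∈rest with ∈-sigmaWith⁻ as f c∈rest
  ...   | a' , b , a'∈ , b∈ , refl = a' , b , there a'∈ , b∈ , refl

  length-sigmaWith : ∀ as f {c} → (∀ {a} → a ∈ as → length (f a) ≡ c) →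
                     length (sigmaWith as f) ≡ length as * c
  length-sigmaWith []       f fibre = refl
  length-sigmaWith (a ∷ as) f {c} fibre = begin
    length (map (g a) (f a) ++ sigmaWith as f)        ≡⟨ length-++ (map (g a) (f a)) ⟩
    length (map (g a) (f a)) + length (sigmaWith as f) ≡⟨ cong₂ _+_ (trans (length-map (g a) (f a)) (fibre (here refl)))
                                                                 (length-sigmaWith as f (fibre ∘ there)) ⟩
    c + length as * c                                  ∎
    where open ≡-Reasoning

  sigmaWith⁺ : (∀ {a a' b b'} → g a b ≡ g a' b' → a ≡ a' × b ≡ b') →
               ∀ {as f} → Unique as → (∀ a → Unique (f a)) → Unique (sigmaWith as f)
  sigmaWith⁺ g-inj {[]}     []           f! = []
  sigmaWith⁺ g-inj {a ∷ as} {f} (a∉ ∷ as!) f! =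
    Unique.++⁺ (Unique.map⁺ (proj₂ ∘ g-inj) (f! a)) (sigmaWith⁺ g-inj as! f!) disjoint
    where
    disjoint : ∀ {c} → ¬ (c ∈ map (g a) (f a) × c ∈ sigmaWith as f)
    disjoint (c∈map , c∈rest) with ∈-map⁻ (g a) c∈map | ∈-sigmaWith⁻ as f c∈rest
    ... | _ , _ , refl | a' , _ , a'∈ , _ , eq =
      All¬⇒¬Any a∉ (subst (_∈ as) (sym (proj₁ (g-inj eq))) a'∈)

remove : ∀ {n} → Fin n → List (Fin n) → List (Fin n)
remove x = filter (λ y → ¬? (y ≟ x))

length-remove : ∀ {n} {x : Fin n} {ys} → Unique ys → x ∈ ys → suc (length (remove x ys)) ≡ length ys
length-remove {x = x} {y ∷ ys} (y∉ ∷ ys!) x∈ with y ≟ x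
... | yes refl = cong (suc ∘ length) (filter-all (λ y → ¬? (y ≟ x)) (All.map (_∘ sym) y∉))
length-remove {x = x} {y ∷ ys} (y∉ ∷ ys!) (here refl)  | no y≢x = ⊥-elim (y≢x refl)
length-remove {x = x} {y ∷ ys} (y∉ ∷ ys!) (there x∈) | no y≢x = cong suc (length-remove ys! x∈)

LookupInjective : ∀ {A : Set} {m} → Vec A m → Set
LookupInjective {m = m} v = ∀ (i j : Fin m) → lookup v i ≡ lookup v j → i ≡ j

Fresh : ∀ {A : Set} {m} → A → Vec A m → Set
Fresh {m = m} x v = ∀ (i : Fin m) → lookup v i ≢ x

module _ {A : Set} {m : ℕ} {x : A} {v : Vec A m} where

  lookupInjective-∷⁻ : LookupInjective (x ∷ v) → Fresh x v × LookupInjective v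
  lookupInjective-∷⁻ inj =
    (λ i eq → 0≢1+n (sym (inj (suc i) zero eq))) , (λ i j eq → suc-injective (inj (suc i) (suc j) eq))

  lookupInjective-∷⁺ : Fresh x v → LookupInjective v → LookupInjective (x ∷ v)
  lookupInjective-∷⁺ fresh inj zero    zero    eq = refl
  lookupInjective-∷⁺ fresh inj zero    (suc j) eq = ⊥-elim (fresh j (sym eq))
  lookupInjective-∷⁺ fresh inj (suc i) zero    eq = ⊥-elim (fresh i eq)
  lookupInjective-∷⁺ fresh inj (suc i) (suc j) eq = cong suc (inj i j eq)

unused : ∀ {n m} → Vec (Fin n) m → List (Fin n)
unused {n} []      = allFin n
unused     (x ∷ v) = remove x (unused v)

unused-unique : ∀ {n m} (v : Vec (Fin n) m) → Unique (unused v)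
unused-unique {n} []      = Unique.allFin⁺ n
unused-unique     (x ∷ v) = Unique.filter⁺ (λ y → ¬? (y ≟ x)) (unused-unique v)

∈-unused⁻ : ∀ {n m} (v : Vec (Fin n) m) {y} → y ∈ unused v → Fresh y v
∈-unused⁻ (x ∷ v) y∈ zero    eq = proj₂ (∈-filter⁻ (λ y → ¬? (y ≟ x)) {xs = unused v} y∈) (sym eq)
∈-unused⁻ (x ∷ v) y∈ (suc i) eq = ∈-unused⁻ v (proj₁ (∈-filter⁻ (λ y → ¬? (y ≟ x)) {xs = unused v} y∈)) i eq

∈-unused⁺ : ∀ {n m} (v : Vec (Fin n) m) {y} → Fresh y v → y ∈ unused v
∈-unused⁺ []      {y} fresh = ∈-allFin y
∈-unused⁺ (x ∷ v)     fresh =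
  ∈-filter⁺ (λ y → ¬? (y ≟ x)) (∈-unused⁺ v (fresh ∘ suc)) (λ eq → fresh zero (sym eq))

length-unused : ∀ {n m} (v : Vec (Fin n) m) → LookupInjective v → length (unused v) ≡ n ∸ m
length-unused {n} []      _   = length-tabulate {n = n} (λ i → i)
length-unused {n} {suc m} (x ∷ v) inj with lookupInjective-∷⁻ inj
... | fresh , inj′ = begin
  length (remove x (unused v))       ≡⟨ cong pred (length-remove (unused-unique v) (∈-unused⁺ v fresh)) ⟩
  pred (length (unused v))           ≡⟨ cong pred (length-unused v inj′) ⟩
  pred (n ∸ m)                       ≡⟨ pred[m∸n]≡m∸[1+n] n m ⟩
  n ∸ suc m                          ∎
  where open ≡-Reasoning

injectiveVectors : ∀ n m → List (Vec (Fin n) m)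
injectiveVectors n zero    = [ [] ]
injectiveVectors n (suc m) = sigmaWith (λ v x → x ∷ v) (injectiveVectors n m) unused

injectiveVectors-unique : ∀ n m → Unique (injectiveVectors n m)
injectiveVectors-unique n zero    = All.[] ∷ []
injectiveVectors-unique n (suc m) =
  sigmaWith⁺ (λ v x → x ∷ v) (swap ∘ ∷-injective) (injectiveVectors-unique n m) unused-unique

∈-injectiveVectors⁻ : ∀ n m {v} → v ∈ injectiveVectors n m → LookupInjective v
∈-injectiveVectors⁻ n zero    {[]} _ ()
∈-injectiveVectors⁻ n (suc m) v∈ with ∈-sigmaWith⁻ (λ v x → x ∷ v) (injectiveVectors n m) unused v∈
... | v , x , v∈′ , x∈ , refl = lookupInjective-∷⁺ (∈-unused⁻ v x∈) (∈-injectiveVectors⁻ n m v∈′)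

∈-injectiveVectors⁺ : ∀ n m (v : Vec (Fin n) m) → LookupInjective v → v ∈ injectiveVectors n m
∈-injectiveVectors⁺ n zero    []      _   = here refl
∈-injectiveVectors⁺ n (suc m) (x ∷ v) inj with lookupInjective-∷⁻ inj
... | fresh , inj′ = ∈-sigmaWith⁺ (λ v x → x ∷ v) (∈-injectiveVectors⁺ n m v inj′) (∈-unused⁺ v fresh)

length-injectiveVectors : ∀ n m → m ≤ n → length (injectiveVectors n m) * (n ∸ m) ! ≡ n !
length-injectiveVectors n zero    _     = *-identityˡ (n !)
length-injectiveVectors n (suc m) 1+m≤n = begin
  length (injectiveVectors n (suc m)) * (n ∸ suc m) ! ≡⟨ cong (_* (n ∸ suc m) !) count-step ⟩
  ℓ * (n ∸ m) * (n ∸ suc m) !                         ≡⟨ *-assoc ℓ (n ∸ m) _ ⟩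
  ℓ * ((n ∸ m) * (n ∸ suc m) !)                       ≡⟨ cong (λ k → ℓ * (k * (n ∸ suc m) !)) n∸m≡1+n∸[1+m] ⟩
  ℓ * (suc (n ∸ suc m)) !                             ≡⟨ cong (λ k → ℓ * k !) n∸m≡1+n∸[1+m] ⟨
  ℓ * (n ∸ m) !                                       ≡⟨ length-injectiveVectors n m (<⇒≤ 1+m≤n) ⟩
  n !                                                 ∎
  where
  open ≡-Reasoning
  ℓ : ℕ
  ℓ = length (injectiveVectors n m)
  n∸m≡1+n∸[1+m] : n ∸ m ≡ suc (n ∸ suc m)
  n∸m≡1+n∸[1+m] = +-∸-assoc 1 1+m≤n
  count-step : length (injectiveVectors n (suc m)) ≡ ℓ * (n ∸ m)
  count-step = length-sigmaWith (λ v x → x ∷ v) (injectiveVectors n m) unused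
                 (λ {v} v∈ → length-unused v (∈-injectiveVectors⁻ n m v∈))

elements : ∀ {n} → Subset n → List (Fin n)
elements []            = []
elements (inside  ∷ p) = zero ∷ map suc (elements p)
elements (outside ∷ p) = map suc (elements p)

∈-elements⁺ : ∀ {n} {p : Subset n} {x} → x ∈ₛ p → x ∈ elements p
∈-elements⁺ {p = inside  ∷ p} here            = here refl
∈-elements⁺ {p = inside  ∷ p} (there x∈p)     = there (∈-map⁺ suc (∈-elements⁺ x∈p))
∈-elements⁺ {p = outside ∷ p} (there x∈p)     = ∈-map⁺ suc (∈-elements⁺ x∈p)

∈-elements⁻ : ∀ {n} (p : Subset n) {x} → x ∈ elements p → x ∈ₛ p
∈-elements⁻ (inside ∷ p) (here refl) = here
∈-elements⁻ (inside ∷ p) (there x∈) with ∈-map⁻ suc x∈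
... | _ , y∈ , refl = there (∈-elements⁻ p y∈)
∈-elements⁻ (outside ∷ p) x∈ with ∈-map⁻ suc x∈
... | _ , y∈ , refl = there (∈-elements⁻ p y∈)

elements-unique : ∀ {n} (p : Subset n) → Unique (elements p)
elements-unique []            = []
elements-unique (inside  ∷ p) = ¬Any⇒All¬ _ zero∉ ∷ Unique.map⁺ suc-injective (elements-unique p)
  where zero∉ : zero ∉ map suc (elements p)
        zero∉ zero∈ with ∈-map⁻ suc zero∈
        ... | _ , _ , ()
elements-unique (outside ∷ p) = Unique.map⁺ suc-injective (elements-unique p)

length-elements : ∀ {n} (p : Subset n) → length (elements p) ≡ ∣ p ∣
length-elements []            = refl
length-elements (inside  ∷ p) = cong suc (trans (length-map suc (elements p)) (length-elements p))
length-elements (outside ∷ p) = trans (length-map suc (elements p)) (length-elements p)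

module _ {A : Set} (xs ys : List A) where

  splitVectors : ℕ → (m : ℕ) → List (Vec A m)
  splitVectors a       zero    = [ [] ]
  splitVectors zero    (suc m) = sigmaWith _∷_ ys (const (splitVectors zero m))
  splitVectors (suc a) (suc m) = sigmaWith _∷_ xs (const (splitVectors a m))

  splitVectors-unique : Unique xs → Unique ys → ∀ a m → Unique (splitVectors a m)
  splitVectors-unique xs! ys! a       zero    = All.[] ∷ []
  splitVectors-unique xs! ys! zero    (suc m) =
    sigmaWith⁺ _∷_ ∷-injective ys! (const (splitVectors-unique xs! ys! zero m))
  splitVectors-unique xs! ys! (suc a) (suc m) =
    sigmaWith⁺ _∷_ ∷-injective xs! (const (splitVectors-unique xs! ys! a m))

  ∈-splitVectors⁻ : ∀ a m {v} → v ∈ splitVectors a m → ∀ i → toℕ i ℕ.< a → lookup v i ∈ xs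
  ∈-splitVectors⁻ (suc a) (suc m) v∈ i i<a
    with ∈-sigmaWith⁻ _∷_ xs (const (splitVectors a m)) v∈
  ∈-splitVectors⁻ (suc a) (suc m) v∈ zero    _         | x , w , x∈ , _  , refl = x∈
  ∈-splitVectors⁻ (suc a) (suc m) v∈ (suc i) (s≤s i<a) | x , w , _  , w∈ , refl = ∈-splitVectors⁻ a m w∈ i i<a

  ∈-splitVectors⁺ : ∀ a m (v : Vec A m) → (∀ i → toℕ i ℕ.< a → lookup v i ∈ xs) →
                    (∀ i → a ≤ toℕ i → lookup v i ∈ ys) → v ∈ splitVectors a m
  ∈-splitVectors⁺ a       zero    []      _     _     = here refl
  ∈-splitVectors⁺ zero    (suc m) (x ∷ v) early late =
    ∈-sigmaWith⁺ _∷_ (late zero z≤n) (∈-splitVectors⁺ zero m v (λ _ ()) (λ i _ → late (suc i) z≤n))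
  ∈-splitVectors⁺ (suc a) (suc m) (x ∷ v) early late =
    ∈-sigmaWith⁺ _∷_ (early zero (s≤s z≤n))
      (∈-splitVectors⁺ a m v (λ i i<a → early (suc i) (s≤s i<a)) (λ i a≤i → late (suc i) (s≤s a≤i)))

  length-splitVectors : ∀ a m → a ≤ m → length (splitVectors a m) ≡ length xs ^ a * length ys ^ (m ∸ a)
  length-splitVectors zero    zero    _ = refl
  length-splitVectors zero    (suc m) _ = begin
    length (splitVectors zero (suc m))      ≡⟨ length-sigmaWith _∷_ ys _ (λ _ → refl) ⟩
    length ys * length (splitVectors zero m) ≡⟨ cong (length ys *_) (length-splitVectors zero m z≤n) ⟩
    length ys * (1 * length ys ^ m)          ≡⟨ cong (length ys *_) (*-identityˡ _) ⟩
    length ys ^ suc m                        ≡⟨ *-identityˡ _ ⟨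
    1 * length ys ^ suc m                    ∎
    where open ≡-Reasoning
  length-splitVectors (suc a) (suc m) (s≤s a≤m) = begin
    length (splitVectors (suc a) (suc m))            ≡⟨ length-sigmaWith _∷_ xs _ (λ _ → refl) ⟩
    length xs * length (splitVectors a m)            ≡⟨ cong (length xs *_) (length-splitVectors a m a≤m) ⟩
    length xs * (length xs ^ a * length ys ^ (m ∸ a)) ≡⟨ *-assoc (length xs) _ _ ⟨
    length xs ^ suc a * length ys ^ (m ∸ a)           ∎
    where open ≡-Reasoning

StrictlyIncreasing : ∀ {k n} → (Fin k → Fin n) → Set
StrictlyIncreasing ι = ∀ a b → a < b → ι a < ι b

module _ {K N : ℕ} (h : Fin K → Fin N) where

  below : Fin K → Subset K
  below a = tabulate (λ b → does (h b <? h a))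

  ∈-below⁺ : ∀ {a b} → h b < h a → b ∈ₛ below a
  ∈-below⁺ {a} {b} hb<ha = lookup⇒[]= b (below a) (trans (lookup∘tabulate _ b) (dec-true (h b <? h a) hb<ha))

  ∈-below⁻ : ∀ {a b} → b ∈ₛ below a → h b < h a
  ∈-below⁻ {a} {b} b∈ = decidable-stable (h b <? h a) λ hb≮ha →
    false≢true (trans (sym (dec-false (h b <? h a) hb≮ha)) (trans (sym (lookup∘tabulate _ b)) ([]=⇒lookup b∈)))
    where false≢true : false ≢ true
          false≢true ()

  ∣below∣<K : ∀ a → ∣ below a ∣ ℕ.< K
  ∣below∣<K a = subst (∣ below a ∣ ℕ.<_) (∣⊤∣≡n K)
    (p⊂q⇒∣p∣<∣q∣ ((λ _ → ∈⊤) , a , ∈⊤ , <-irrefl refl ∘ ∈-below⁻))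

  rank : Fin K → Fin K
  rank a = fromℕ< (∣below∣<K a)

  toℕ-rank : ∀ a → toℕ (rank a) ≡ ∣ below a ∣
  toℕ-rank a = toℕ-fromℕ< (∣below∣<K a)

  rank-mono : ∀ {a b} → h a < h b → rank a < rank b
  rank-mono {a} {b} ha<hb = subst₂ ℕ._<_ (sym (toℕ-rank a)) (sym (toℕ-rank b)) (p⊂q⇒∣p∣<∣q∣ below-a⊂below-b)
    where
    below-a⊂below-b : below a ⊂ below b
    below-a⊂below-b = (λ c∈ → ∈-below⁺ (<-trans (∈-below⁻ c∈) ha<hb)) , a , ∈-below⁺ ha<hb , <-irrefl refl ∘ ∈-below⁻

  module _ (h-injective : ∀ a b → h a ≡ h b → a ≡ b) where

    rank-reflects : ∀ {a b} → rank a < rank b → h a < h b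
    rank-reflects {a} {b} ra<rb with <-cmp (h a) (h b)
    ... | tri< ha<hb _ _ = ha<hb
    ... | tri≈ _ ha≡hb _ = ⊥-elim (<-irrefl (cong rank (h-injective a b ha≡hb)) ra<rb)
    ... | tri> _ _ hb<ha = ⊥-elim (<-asym ra<rb (rank-mono hb<ha))

    rank-injective : ∀ a b → rank a ≡ rank b → a ≡ b
    rank-injective a b ra≡rb with <-cmp (h a) (h b)
    ... | tri< ha<hb _ _ = ⊥-elim (<-irrefl ra≡rb (rank-mono ha<hb))
    ... | tri≈ _ ha≡hb _ = h-injective a b ha≡hb
    ... | tri> _ _ hb<ha = ⊥-elim (<-irrefl (sym ra≡rb) (rank-mono hb<ha))

increasing⇒injective : ∀ {k n} {ι : Fin k → Fin n} → StrictlyIncreasing ι → ∀ a b → ι a ≡ ι b → a ≡ b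
increasing⇒injective {ι = ι} ι-inc a b ιa≡ιb with <-cmp a b
... | tri< a<b _ _ = ⊥-elim (<-irrefl ιa≡ιb (ι-inc a b a<b))
... | tri≈ _ a≡b _ = a≡b
... | tri> _ _ b<a = ⊥-elim (<-irrefl (sym ιa≡ιb) (ι-inc b a b<a))

subpattern : ∀ {K n r} → CWord n r → (Fin K → Fin n) → CWord K r
subpattern ψ ι = cw (tabulate (rank (lookup (word ψ) ∘ ι))) (tabulate (lookup (col ψ) ∘ ι))

module _ {K n r : ℕ} (ψ : CWord n r) {ι : Fin K → Fin n} (ψ-perm : InS ψ) (ι-inc : StrictlyIncreasing ι) where

  private
    h : Fin K → Fin n
    h = lookup (word ψ) ∘ ι

    h-injective : ∀ a b → h a ≡ h b → a ≡ b
    h-injective a b = increasing⇒injective ι-inc a b ∘ ψ-perm (ι a) (ι b)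

    lookup-word : ∀ a → lookup (word (subpattern ψ ι)) a ≡ rank h a
    lookup-word = lookup∘tabulate (rank h)

  subpattern-isPerm : InS (subpattern ψ ι)
  subpattern-isPerm a b eq = rank-injective h h-injective a b
    (trans (sym (lookup-word a)) (trans eq (lookup-word b)))

  contains-subpattern : Contains ψ (subpattern ψ ι)
  contains-subpattern = ι , ι-inc , order-iso , (λ a → sym (lookup∘tabulate _ a))
    where
    order-iso : ∀ a b → (h a < h b) ⇔ (lookup (word (subpattern ψ ι)) a < lookup (word (subpattern ψ ι)) b)
    order-iso a b = mk⇔
      (subst₂ _<_ (sym (lookup-word a)) (sym (lookup-word b)) ∘ rank-mono h)
      (rank-reflects h h-injective ∘ subst₂ _<_ (lookup-word a) (lookup-word b))

increasing-spread : ∀ {k n} (ι : Fin (suc k) → Fin n) → StrictlyIncreasing ι →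
                    toℕ (ι zero) + k ℕ.≤ toℕ (ι (fromℕ k))
increasing-spread {zero}  ι ι-inc = ≤-reflexive (+-identityʳ _)
increasing-spread {suc k} ι ι-inc = begin
  toℕ (ι zero) + suc k       ≡⟨ +-suc (toℕ (ι zero)) k ⟩
  suc (toℕ (ι zero)) + k     ≤⟨ +-monoˡ-≤ k (ι-inc zero (suc zero) (s≤s z≤n)) ⟩
  toℕ (ι (suc zero)) + k     ≤⟨ increasing-spread (ι ∘ suc) (λ a b a<b → ι-inc (suc a) (suc b) (s≤s a<b)) ⟩
  toℕ (ι (suc (fromℕ k)))    ∎
  where open ≤-Reasoning

increasing-head-fits : ∀ {k n} (ι : Fin (suc k) → Fin n) → StrictlyIncreasing ι → toℕ (ι zero) + k ℕ.< n
increasing-head-fits ι ι-inc = ≤-<-trans (increasing-spread ι ι-inc) (toℕ<n _)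

module _ {n k : ℕ} (i : Fin n) (fits : toℕ i + k ℕ.< n) where

  private
    fits-at : ∀ (a : Fin (suc k)) → toℕ i + toℕ a ℕ.< n
    fits-at a = ≤-<-trans (+-monoʳ-≤ (toℕ i) (toℕ≤pred[n] a)) fits

  window : Fin (suc k) → Fin n
  window a = fromℕ< (fits-at a)

  toℕ-window : ∀ a → toℕ (window a) ≡ toℕ i + toℕ a
  toℕ-window a = toℕ-fromℕ< (fits-at a)

  window-increasing : StrictlyIncreasing window
  window-increasing a b a<b = subst₂ ℕ._<_ (sym (toℕ-window a)) (sym (toℕ-window b)) (+-monoʳ-< (toℕ i) a<b)

  window-zero : window zero ≡ i
  window-zero = toℕ-injective (trans (toℕ-window zero) (+-identityʳ (toℕ i)))

AvoidsT : ∀ {n r} → ℕ → Subset r → CWord n r → Set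
AvoidsT {r = r} k' I ψ = ∀ (m : Fin (suc k')) (φ : CWord (suc k') r) → InT m I φ → Avoids ψ φ

StartColoursOutside : ∀ {n r} → ℕ → Subset r → CWord n r → Set
StartColoursOutside {n} k' I ψ = ∀ (i : Fin n) → toℕ i ℕ.+ k' ℕ.< n → lookup (col ψ) i ∉ₛ I

module _ {n r k' : ℕ} {I : Subset r} (ψ : CWord n r) where

  startColoursOutside⇒avoidsT : StartColoursOutside k' I ψ → AvoidsT k' I ψ
  startColoursOutside⇒avoidsT starts∉I m φ (_ , _ , φ₀∈I) (ι , ι-inc , _ , same-colour) =
    starts∉I (ι zero) (increasing-head-fits ι ι-inc) (subst (_∈ₛ I) (sym (same-colour zero)) φ₀∈I)

  avoidsT⇒startColoursOutside : InS ψ → AvoidsT k' I ψ → StartColoursOutside k' I ψ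
  avoidsT⇒startColoursOutside ψ-perm avoids i fits ψᵢ∈I =
    avoids _ (subpattern ψ ι) (subpattern-isPerm ψ ψ-perm ι-inc , refl , ψ[ι₀]∈I)
           (contains-subpattern ψ ψ-perm ι-inc)
    where
    ι : Fin (suc k') → Fin n
    ι = window i fits
    ι-inc : StrictlyIncreasing ι
    ι-inc = window-increasing i fits
    ψ[ι₀]∈I : lookup (col ψ) (ι zero) ∈ₛ I
    ψ[ι₀]∈I = subst (λ j → lookup (col ψ) j ∈ₛ I) (sym (window-zero i fits)) ψᵢ∈I

cw-injective : ∀ {n r} {w w′ c c′} → cw {n} {r} w c ≡ cw w′ c′ → w ≡ w′ × c ≡ c′
cw-injective refl = refl , refl

length-permutations : ∀ n → length (injectiveVectors n n) ≡ n !
length-permutations n = begin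
  length (injectiveVectors n n)            ≡⟨ *-identityʳ _ ⟨
  length (injectiveVectors n n) * 0 !      ≡⟨ cong (λ k → length (injectiveVectors n n) * k !) (n∸n≡0 n) ⟨
  length (injectiveVectors n n) * (n ∸ n) ! ≡⟨ length-injectiveVectors n n ≤-refl ⟩
  n !                                      ∎
  where open ≡-Reasoning

module _ (n k' : ℕ) {r : ℕ} (I : Subset r) where

  colourings : List (Vec (Fin r) n)
  colourings = splitVectors (elements (∁ I)) (allFin r) (n ∸ k') n

  avoiders : List (CWord n r)
  avoiders = sigmaWith cw (injectiveVectors n n) (const colourings)

  avoiders-unique : Unique avoiders
  avoiders-unique = sigmaWith⁺ cw cw-injective (injectiveVectors-unique n n)
    (const (splitVectors-unique _ _ (elements-unique (∁ I)) (Unique.allFin⁺ r) (n ∸ k') n))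

  ∈-avoiders⁻ : ∀ {ψ} → ψ ∈ avoiders → InS ψ × StartColoursOutside k' I ψ
  ∈-avoiders⁻ ψ∈ with ∈-sigmaWith⁻ cw (injectiveVectors n n) (const colourings) ψ∈
  ... | w , c , w∈ , c∈ , refl = ∈-injectiveVectors⁻ n n w∈ , λ i fits →
    x∈∁p⇒x∉p (∈-elements⁻ (∁ I) (∈-splitVectors⁻ _ _ (n ∸ k') n c∈ i (m+n≤o⇒m≤o∸n (suc (toℕ i)) fits)))

  ∈-avoiders⁺ : k' ≤ n → ∀ {ψ} → InS ψ → StartColoursOutside k' I ψ → ψ ∈ avoiders
  ∈-avoiders⁺ k'≤n {cw w c} ψ-perm starts∉I = ∈-sigmaWith⁺ cw (∈-injectiveVectors⁺ n n w ψ-perm)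
    (∈-splitVectors⁺ _ _ (n ∸ k') n c
      (λ i i<n∸k' → ∈-elements⁺ (x∉p⇒x∈∁p (starts∉I i (m≤o∸n⇒m+n≤o (suc (toℕ i)) k'≤n i<n∸k'))))
      (λ i _ → ∈-allFin (lookup c i)))

  length-avoiders : k' ≤ n → length avoiders ≡ r ^ k' * (r ∸ ∣ I ∣) ^ (n ∸ k') * n !
  length-avoiders k'≤n = begin
    length avoiders
      ≡⟨ length-sigmaWith cw (injectiveVectors n n) (const colourings) (λ _ → refl) ⟩
    length (injectiveVectors n n) * length colourings
      ≡⟨ cong₂ _*_ (length-permutations n) (length-splitVectors _ _ (n ∸ k') n (m∸n≤m n k')) ⟩
    n ! * (length (elements (∁ I)) ^ (n ∸ k') * length (allFin r) ^ (n ∸ (n ∸ k')))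
      ≡⟨ cong₂ (λ g a → n ! * (g ^ (n ∸ k') * a)) (trans (length-elements (∁ I)) (∣∁p∣≡n∸∣p∣ I))
                                                  (cong₂ _^_ (length-tabulate {n = r} (λ x → x)) (m∸[m∸n]≡n k'≤n)) ⟩
    n ! * ((r ∸ ∣ I ∣) ^ (n ∸ k') * r ^ k')
      ≡⟨ *-comm (n !) _ ⟩
    (r ∸ ∣ I ∣) ^ (n ∸ k') * r ^ k' * n !
      ≡⟨ cong (_* n !) (*-comm _ (r ^ k')) ⟩
    r ^ k' * (r ∸ ∣ I ∣) ^ (n ∸ k') * n !
      ∎
    where open ≡-Reasoning

corollary2 : (k' r d n : ℕ) (I : Subset r) → 1 ≤ r → ∣ I ∣ ≡ d → suc k' ≤ n →
    ∃ λ (L : List (CWord n r)) →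
    Unique L ×
    (∀ ψ → (ψ ∈ L) ⇔ (InS ψ × (∀ (m : Fin (suc k')) (φ : CWord (suc k') r) → InT m I φ → Avoids ψ φ))) ×
    (length L ≡ r ^ k' * (r ∸ d) ^ (n ∸ k') * n !)
corollary2 k' r d n I _ refl 1+k'≤n =
  avoiders n k' I , avoiders-unique n k' I , characterisation , length-avoiders n k' I k'≤n
  where
  k'≤n : k' ≤ n
  k'≤n = ≤-trans (n≤1+n k') 1+k'≤n
  characterisation : ∀ ψ → (ψ ∈ avoiders n k' I) ⇔ (InS ψ × AvoidsT k' I ψ)
  characterisation ψ = mk⇔
    (λ ψ∈ → let ψ-perm , starts∉I = ∈-avoiders⁻ n k' I ψ∈ in ψ-perm , startColoursOutside⇒avoidsT ψ starts∉I)
    (λ (ψ-perm , avoids) → ∈-avoiders⁺ n k' I k'≤n ψ-perm (avoidsT⇒startColoursOutside ψ ψ-perm avoids))
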